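{- Let $\mathcal F\subseteq\mathcal P([n])$ be a diamond-saturated family with $\emptyset,[n]\notin\mathcal F$. Let $A$ be a minimal element of $\mathcal F$. Then there exist at least $|A|$ sets $F\in\mathcal F$ with $|F|\geq |A|$. Similarly, if $X$ is a maximal element of $\mathcal F$, then there exist at least $n-|X|$ sets $G\in\mathcal F$ with $|G|\leq|X|$.
   Context: $\mathcal P([n])$ is the power set of $[n]=\{1,\dots,n\}$ ordered by inclusion. An induced diamond in a family is four distinct sets $D,P,Q,T$ of the family with $D\subsetneq P\subsetneq T$, $D\subsetneq Q\subsetneq T$ and $P,Q$ incomparable. A family $\mathcal F\subseteq\mathcal P([n])$ is diamond-saturated if it contains no induced diamond, but for every $S\in\mathcal P([n])\setminus\mathcal F$, $\mathcal F\cup\{S\}$ contains an induced diamond. Minimal/maximal elements of $\mathcal F$ are with respect to inclusion. -}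

module Defs where

open import Data.Nat using (ℕ; _≥_; _≤_; _∸_)
open import Data.Fin.Subset using (Subset; _⊆_; _⊂_; ∣_∣; ⊥; ⊤)
open import Data.Product using (_×_; Σ; ∃; _,_)
open import Data.Sum using (_⊎_)
open import Data.List using (List; length)
open import Data.List.Relation.Unary.All using (All)
open import Data.List.Relation.Unary.Unique.Propositional using (Unique)
open import Relation.Nullary using (¬_)
open import Relation.Binary.PropositionalEquality using (_≡_)

-- A family of subsets of [n] = Fin n, given as a predicate on Subset n.
Family : ℕ → Set₁
Family n = Subset n → Set

Incomparable : ∀ {n} → Subset n → Subset n → Set
Incomparable P Q = ¬ (P ⊆ Q) × ¬ (Q ⊆ P)

-- An induced diamond: D ⊂ P ⊂ T, D ⊂ Q ⊂ T, P, Q incomparable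
-- (distinctness of the four sets follows from these conditions).
IsDiamond : ∀ {n} → Subset n → Subset n → Subset n → Subset n → Set
IsDiamond D P Q T = D ⊂ P × P ⊂ T × D ⊂ Q × Q ⊂ T × Incomparable P Q

HasDiamond : ∀ {n} → Family n → Set
HasDiamond {n} F =
  Σ (Subset n) λ D → Σ (Subset n) λ P → Σ (Subset n) λ Q → Σ (Subset n) λ T →
    F D × F P × F Q × F T × IsDiamond D P Q T

insert : ∀ {n} → Family n → Subset n → Family n
insert F S X = F X ⊎ X ≡ S

DiamondSaturated : ∀ {n} → Family n → Set
DiamondSaturated F =
  ¬ HasDiamond F × (∀ S → ¬ F S → HasDiamond (insert F S))

Minimal : ∀ {n} → Family n → Subset n → Set
Minimal F A = F A × (∀ B → F B → ¬ (B ⊂ A))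

Maximal : ∀ {n} → Family n → Subset n → Set
Maximal F X = F X × (∀ B → F B → ¬ (X ⊂ B))

AtLeast : ∀ {n} → ℕ → (Subset n → Set) → Set
AtLeast {n} k P =
  Σ (List (Subset n)) λ xs → Unique xs × All P xs × k ≤ length xs

-- Let a ∈ A with A minimal in F. The set A - a is not in F, so adding it creates an
-- induced diamond, and minimality of A forces A - a to be its bottom. If both middle sets
-- contained a, then A itself would be the bottom of a diamond inside F; hence one of them
-- is a set G_a ∈ F with A - a ⊂ G_a and a ∉ G_a. Then ∣G_a∣ ≥ ∣A∣, and the G_a are pairwise
-- distinct since G_a contains every b ∈ A except a. The statement for maximal sets follows
-- by passing to the complemented family {∁ G ∣ G ∈ F}, which is again diamond-saturated.
module Submission where

open import Defs
open import Data.Nat using (ℕ; suc; _≥_; _≤_; _∸_)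
open import Data.Fin.Subset
  using (Subset; ∣_∣; ⊥; ⊤; _∈_; _∉_; _⊆_; _⊈_; _⊂_; _-_; ∁; inside; outside)
open import Data.Product using (_×_; Σ; _,_; proj₁)
open import Relation.Nullary using (¬_; yes; no; contradiction)
open import Data.Nat.Properties using (≤-reflexive; ≤-trans; ∸-monoʳ-≤; m∸[m∸n]≡n)
open import Data.Fin using (Fin; suc; _≟_)
open import Data.Fin.Properties using (0≢1+n; suc-injective)
open import Data.Fin.Subset.Properties
  using (_∈?_; _⊂?_; ∪-∩-booleanAlgebra; p─⊥≡p; ⊂-trans; ⊂-irref; ⊆-trans;
         x∈p⇒p-x⊂p; x∈p∧x≢y⇒x∈p-y; p⊂q⇒∣p∣<∣q∣; p⊆q⇒∁p⊇∁q; p⊂q⇒∁p⊃∁q;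
         ∣∁p∣≡n∸∣p∣; ∣p∣≤n)
open import Algebra.Lattice.Properties.BooleanAlgebra using (¬-involutive)
open import Data.Vec using ([]; _∷_; here; there)
open import Data.List using (List; []; _∷_; length; map)
open import Data.List.Properties using (length-map)
open import Data.List.Relation.Unary.All as All using (All; []; _∷_)
import Data.List.Relation.Unary.All.Properties as All
open import Data.List.Relation.Unary.Unique.Propositional using (Unique; []; _∷_)
import Data.List.Relation.Unary.Unique.Propositional.Properties as Unique
open import Data.Sum using (inj₁; inj₂)
open import Function using (_∘_)
open import Relation.Nullary.Decidable using (decidable-stable)
open import Relation.Binary.PropositionalEquality
  using (_≡_; _≢_; refl; sym; cong; subst; subst₂)

private
  variable
    n : ℕ

∁-involutive : (p : Subset n) → ∁ (∁ p) ≡ p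
∁-involutive {n} = ¬-involutive (∪-∩-booleanAlgebra n)

∁-injective : {p q : Subset n} → ∁ p ≡ ∁ q → p ≡ q
∁-injective {p = p} {q} eq = begin
  p         ≡⟨ sym (∁-involutive p) ⟩
  ∁ (∁ p)   ≡⟨ cong ∁ eq ⟩
  ∁ (∁ q)   ≡⟨ ∁-involutive q ⟩
  q         ∎
  where open Relation.Binary.PropositionalEquality.≡-Reasoning

p⊆q∧q⊈p⇒p⊂q : {p q : Subset n} → p ⊆ q → q ⊈ p → p ⊂ q
p⊆q∧q⊈p⇒p⊂q {p = p} {q} p⊆q q⊈p with p ⊂? q
... | yes p⊂q = p⊂q
... | no  p⊄q = contradiction (λ {x} → q⊆p {x}) q⊈p
  where
  q⊆p : q ⊆ p
  q⊆p {x} x∈q = decidable-stable (x ∈? p) (λ x∉p → p⊄q (p⊆q , x , x∈q , x∉p))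

x∈q∧p-x⊆q⇒p⊆q : {p q : Subset n} {x : Fin n} → x ∈ q → p - x ⊆ q → p ⊆ q
x∈q∧p-x⊆q⇒p⊆q {x = x} x∈q p-x⊆q {y} y∈p with y ≟ x
... | yes refl = x∈q
... | no  y≢x  = p-x⊆q (x∈p∧x≢y⇒x∈p-y y∈p y≢x)

x∈p⇒∣p∣≡1+∣p-x∣ : {p : Subset n} {x : Fin n} → x ∈ p → ∣ p ∣ ≡ suc ∣ p - x ∣
x∈p⇒∣p∣≡1+∣p-x∣ {p = inside ∷ p}  here        = cong (suc ∘ ∣_∣) (sym (p─⊥≡p p))
x∈p⇒∣p∣≡1+∣p-x∣ {p = inside ∷ p}  (there x∈p) = cong suc (x∈p⇒∣p∣≡1+∣p-x∣ x∈p)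
x∈p⇒∣p∣≡1+∣p-x∣ {p = outside ∷ p} (there x∈p) = x∈p⇒∣p∣≡1+∣p-x∣ x∈p

∣∁p∣≤∣q∣⇒∣∁q∣≤∣p∣ : (p q : Subset n) → ∣ ∁ p ∣ ≤ ∣ q ∣ → ∣ ∁ q ∣ ≤ ∣ p ∣
∣∁p∣≤∣q∣⇒∣∁q∣≤∣p∣ {n} p q ∣∁p∣≤∣q∣ = begin
  ∣ ∁ q ∣            ≡⟨ ∣∁p∣≡n∸∣p∣ q ⟩
  n ∸ ∣ q ∣          ≤⟨ ∸-monoʳ-≤ n ∣∁p∣≤∣q∣ ⟩
  n ∸ ∣ ∁ p ∣        ≡⟨ cong (n ∸_) (∣∁p∣≡n∸∣p∣ p) ⟩
  n ∸ (n ∸ ∣ p ∣)    ≡⟨ m∸[m∸n]≡n (∣p∣≤n p) ⟩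
  ∣ p ∣              ∎
  where open Data.Nat.Properties.≤-Reasoning

module _ {B : Set} where

  image : (A : Subset n) → (∀ {a} → a ∈ A → B) → List B
  image []            g = []
  image (inside ∷ A)  g = g here ∷ image A (g ∘ there)
  image (outside ∷ A) g = image A (g ∘ there)

  length-image : (A : Subset n) (g : ∀ {a} → a ∈ A → B) → length (image A g) ≡ ∣ A ∣
  length-image []            g = refl
  length-image (inside ∷ A)  g = cong suc (length-image A (g ∘ there))
  length-image (outside ∷ A) g = length-image A (g ∘ there)

  All-image : {P : B → Set} (A : Subset n) (g : ∀ {a} → a ∈ A → B) →
              (∀ {a} (a∈A : a ∈ A) → P (g a∈A)) → All P (image A g)
  All-image []            g Pg = []
  All-image (inside ∷ A)  g Pg = Pg here ∷ All-image A (g ∘ there) (Pg ∘ there)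
  All-image (outside ∷ A) g Pg = All-image A (g ∘ there) (Pg ∘ there)

  Unique-image : (A : Subset n) (g : ∀ {a} → a ∈ A → B) →
                 (∀ {a b} (a∈A : a ∈ A) (b∈A : b ∈ A) → g a∈A ≡ g b∈A → a ≡ b) →
                 Unique (image A g)
  Unique-image []            g g-inj = []
  Unique-image (inside ∷ A)  g g-inj =
    All-image A (g ∘ there) (λ b∈A eq → 0≢1+n (g-inj here (there b∈A) eq))
    ∷ Unique-image A (g ∘ there) λ a∈A b∈A → suc-injective ∘ g-inj (there a∈A) (there b∈A)
  Unique-image (outside ∷ A) g g-inj =
    Unique-image A (g ∘ there) λ a∈A b∈A → suc-injective ∘ g-inj (there a∈A) (there b∈A)

atLeast-image : {P : Subset n → Set} (A : Subset n) (g : ∀ {a} → a ∈ A → Subset n) →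
                (∀ {a b} (a∈A : a ∈ A) (b∈A : b ∈ A) → g a∈A ≡ g b∈A → a ≡ b) →
                (∀ {a} (a∈A : a ∈ A) → P (g a∈A)) → AtLeast ∣ A ∣ P
atLeast-image A g g-inj Pg =
  image A g , Unique-image A g g-inj , All-image A g Pg , ≤-reflexive (sym (length-image A g))

atLeast-map : {k : ℕ} {P Q : Subset n → Set} (f : Subset n → Subset n) →
              (∀ {p q} → f p ≡ f q → p ≡ q) → (∀ {G} → P G → Q (f G)) →
              AtLeast k P → AtLeast k Q
atLeast-map f f-inj P⇒Qf (Gs , unique , all , k≤) =
  map f Gs , Unique.map⁺ f-inj unique , All.map⁺ (All.map P⇒Qf all) ,
  ≤-trans k≤ (≤-reflexive (sym (length-map f Gs)))

isDiamond-withBottom : {D P Q T B : Subset n} →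
                       IsDiamond D P Q T → B ⊆ P → B ⊆ Q → IsDiamond B P Q T
isDiamond-withBottom (_ , P⊂T , _ , Q⊂T , P⊈Q , Q⊈P) B⊆P B⊆Q =
  p⊆q∧q⊈p⇒p⊂q B⊆P (λ P⊆B → P⊈Q (⊆-trans P⊆B B⊆Q)) , P⊂T ,
  p⊆q∧q⊈p⇒p⊂q B⊆Q (λ Q⊆B → Q⊈P (⊆-trans Q⊆B B⊆P)) , Q⊂T , P⊈Q , Q⊈P

isDiamond-∁ : {D P Q T : Subset n} → IsDiamond D P Q T → IsDiamond (∁ T) (∁ P) (∁ Q) (∁ D)
isDiamond-∁ (D⊂P , P⊂T , D⊂Q , Q⊂T , P⊈Q , Q⊈P) =
  p⊂q⇒∁p⊃∁q P⊂T , p⊂q⇒∁p⊃∁q D⊂P , p⊂q⇒∁p⊃∁q Q⊂T , p⊂q⇒∁p⊃∁q D⊂Q ,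
  (λ ∁P⊆∁Q → Q⊈P (subst₂ _⊆_ (∁-involutive _) (∁-involutive _) (p⊆q⇒∁p⊇∁q ∁P⊆∁Q))) ,
  (λ ∁Q⊆∁P → P⊈Q (subst₂ _⊆_ (∁-involutive _) (∁-involutive _) (p⊆q⇒∁p⊇∁q ∁Q⊆∁P)))

hasDiamond-mono : {G H : Family n} → (∀ {X} → G X → H X) → HasDiamond G → HasDiamond H
hasDiamond-mono G⊆H (D , P , Q , T , D∈G , P∈G , Q∈G , T∈G , diamond) =
  D , P , Q , T , G⊆H D∈G , G⊆H P∈G , G⊆H Q∈G , G⊆H T∈G , diamond

hasDiamond-∁ : {G : Family n} → HasDiamond (G ∘ ∁) → HasDiamond G
hasDiamond-∁ (D , P , Q , T , ∁D∈G , ∁P∈G , ∁Q∈G , ∁T∈G , diamond) =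
  ∁ T , ∁ P , ∁ Q , ∁ D , ∁T∈G , ∁P∈G , ∁Q∈G , ∁D∈G , isDiamond-∁ diamond

insert-elim : {F : Family n} {S X : Subset n} → insert F S X → X ≢ S → F X
insert-elim (inj₁ X∈F) X≢S = X∈F
insert-elim (inj₂ X≡S) X≢S = contradiction X≡S X≢S

DiamondWithBottom : Family n → Subset n → Set
DiamondWithBottom {n} F S =
  Σ (Subset n) λ P → Σ (Subset n) λ Q → Σ (Subset n) λ T → F P × F Q × F T × IsDiamond S P Q T

insertDiamond-bottom : {F : Family n} {S : Subset n} → ¬ HasDiamond F →
                       (∀ B → F B → ¬ B ⊂ S) → HasDiamond (insert F S) → DiamondWithBottom F S
insertDiamond-bottom {F = F} {S} noDiamond nothingBelow
  (D , P , Q , T , D∈ , P∈ , Q∈ , T∈ , diamond@(D⊂P , P⊂T , D⊂Q , Q⊂T , _))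
  with D∈
... | inj₂ refl = P , Q , T , above P∈ D⊂P , above Q∈ D⊂Q , above T∈ (⊂-trans D⊂P P⊂T) , diamond
  where
  above : ∀ {X} → insert F S X → S ⊂ X → F X
  above X∈ S⊂X = insert-elim {F = F} X∈ λ { refl → ⊂-irref refl S⊂X }
... | inj₁ D∈F = contradiction (D , P , Q , T , D∈F , aboveD P∈ D⊂P , aboveD Q∈ D⊂Q ,
                               aboveD T∈ (⊂-trans D⊂P P⊂T) , diamond) noDiamond
  where
  aboveD : ∀ {X} → insert F S X → D ⊂ X → F X
  aboveD X∈ D⊂X = insert-elim {F = F} X∈ λ { refl → nothingBelow D D∈F D⊂X }

diamondSaturated-∁ : {F : Family n} → DiamondSaturated F → DiamondSaturated (F ∘ ∁)
diamondSaturated-∁ {F = F} (noDiamond , saturated) =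
  noDiamond ∘ hasDiamond-∁ ,
  λ S ∁S∉F → hasDiamond-∁ (hasDiamond-mono (complement S) (saturated (∁ S) ∁S∉F))
  where
  complement : ∀ S {X} → insert F (∁ S) X → insert (F ∘ ∁) S (∁ X)
  complement S {X} (inj₁ X∈F)  = inj₁ (subst F (sym (∁-involutive X)) X∈F)
  complement S     (inj₂ refl) = inj₂ (∁-involutive S)

maximal⇒minimal-∁ : {F : Family n} {X : Subset n} → Maximal F X → Minimal (F ∘ ∁) (∁ X)
maximal⇒minimal-∁ {F = F} {X} (X∈F , X-maximal) =
  subst F (sym (∁-involutive X)) X∈F ,
  λ B ∁B∈F B⊂∁X → X-maximal (∁ B) ∁B∈F (subst (_⊂ ∁ B) (∁-involutive X) (p⊂q⇒∁p⊃∁q B⊂∁X))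

minimal-witness : {F : Family n} {A : Subset n} {a : Fin n} →
                  DiamondSaturated F → Minimal F A → a ∈ A →
                  Σ (Subset n) λ G → F G × A - a ⊂ G × a ∉ G
minimal-witness {n} {F} {A} {a} (noDiamond , saturated) (A∈F , A-minimal) a∈A =
  chooseMiddle (insertDiamond-bottom noDiamond nothingBelow (saturated (A - a) A-a∉F))
  where
  A-a⊂A : A - a ⊂ A
  A-a⊂A = x∈p⇒p-x⊂p a∈A

  A-a∉F : ¬ F (A - a)
  A-a∉F A-a∈F = A-minimal (A - a) A-a∈F A-a⊂A

  nothingBelow : ∀ B → F B → ¬ B ⊂ A - a
  nothingBelow B B∈F B⊂A-a = A-minimal B B∈F (⊂-trans B⊂A-a A-a⊂A)


  chooseMiddle : DiamondWithBottom F (A - a) → Σ (Subset n) λ G → F G × A - a ⊂ G × a ∉ G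
  chooseMiddle (P , Q , T , P∈F , Q∈F , T∈F , diamond@(A-a⊂P , _ , A-a⊂Q , _)) with a ∈? P | a ∈? Q
  ... | no a∉P | _      = P , P∈F , A-a⊂P , a∉P
  ... | yes _  | no a∉Q = Q , Q∈F , A-a⊂Q , a∉Q
  ... | yes a∈P | yes a∈Q = contradiction
        (A , P , Q , T , A∈F , P∈F , Q∈F , T∈F ,
         isDiamond-withBottom diamond (x∈q∧p-x⊆q⇒p⊆q a∈P (proj₁ A-a⊂P))
                                      (x∈q∧p-x⊆q⇒p⊆q a∈Q (proj₁ A-a⊂Q)))
        noDiamond

minimal-atLeast : {F : Family n} {A : Subset n} → DiamondSaturated F → Minimal F A →
                  AtLeast ∣ A ∣ (λ G → F G × ∣ G ∣ ≥ ∣ A ∣)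
minimal-atLeast {F = F} {A} sat minA = atLeast-image A G G-injective G-large
  where
  G : ∀ {a} → a ∈ A → Subset _
  G = proj₁ ∘ minimal-witness sat minA

  G-large : ∀ {a} (a∈A : a ∈ A) → F (G a∈A) × ∣ G a∈A ∣ ≥ ∣ A ∣
  G-large a∈A with minimal-witness sat minA a∈A
  ... | _ , G∈F , A-a⊂G , _ =
    G∈F , subst (_≤ _) (sym (x∈p⇒∣p∣≡1+∣p-x∣ a∈A)) (p⊂q⇒∣p∣<∣q∣ A-a⊂G)

  G-injective : ∀ {a b} (a∈A : a ∈ A) (b∈A : b ∈ A) → G a∈A ≡ G b∈A → a ≡ b
  G-injective {a} {b} a∈A b∈A Ga≡Gb with minimal-witness sat minA a∈A | minimal-witness sat minA b∈A
  ... | _ , _ , A-a⊂Ga , _ | _ , _ , _ , b∉Gb = decidable-stable (a ≟ b) λ a≢b →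
    b∉Gb (subst (b ∈_) Ga≡Gb (proj₁ A-a⊂Ga (x∈p∧x≢y⇒x∈p-y b∈A (a≢b ∘ sym))))

maximal-atLeast : {F : Family n} {X : Subset n} → DiamondSaturated F → Maximal F X →
                  AtLeast (n ∸ ∣ X ∣) (λ G → F G × ∣ G ∣ ≤ ∣ X ∣)
maximal-atLeast {n} {F} {X} sat maxX =
  subst (λ k → AtLeast k λ G → F G × ∣ G ∣ ≤ ∣ X ∣) (∣∁p∣≡n∸∣p∣ X)
    (atLeast-map ∁ ∁-injective (λ { {G} (∁G∈F , ∣G∣≥) → ∁G∈F , ∣∁p∣≤∣q∣⇒∣∁q∣≤∣p∣ X G ∣G∣≥ })
      (minimal-atLeast (diamondSaturated-∁ sat) (maximal⇒minimal-∁ maxX)))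

lemma2p5 : (n : ℕ) (F : Family n) → DiamondSaturated F → ¬ F ⊥ → ¬ F ⊤ →
    (∀ A → Minimal F A → AtLeast ∣ A ∣ (λ G → F G × ∣ G ∣ ≥ ∣ A ∣))
    × (∀ X → Maximal F X → AtLeast (n ∸ ∣ X ∣) (λ G → F G × ∣ G ∣ ≤ ∣ X ∣))
lemma2p5 n F sat _ _ = (λ A → minimal-atLeast sat) , (λ X → maximal-atLeast sat)
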